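{- Let $(A,\sigma)$ be a state-morphism BL-algebra. Then $(A,\sigma)$ is semisimple if and only if $\mathrm{Rad}(A)\subseteq\mathrm{Ker}(\sigma)$.
   Context: A BL-algebra is an algebra $(A,\wedge,\vee,\odot,\to,0,1)$ of type $(2,2,2,2,0,0)$ such that $(A,\wedge,\vee,0,1)$ is a bounded lattice, $(A,\odot,1)$ is a commutative monoid, and for all $a,b,c\in A$: $c\le a\to b$ iff $a\odot c\le b$; $a\wedge b=a\odot(a\to b)$; $(a\to b)\vee(b\to a)=1$. A morphism-state-operator on $A$ is a map $\sigma:A\to A$ such that for all $x,y\in A$: $\sigma(0)=0$; $\sigma(x\to y)=\sigma(x)\to\sigma(x\wedge y)$; $\sigma(\sigma(x)\odot\sigma(y))=\sigma(x)\odot\sigma(y)$; $\sigma(\sigma(x)\to\sigma(y))=\sigma(x)\to\sigma(y)$; $\sigma(x\odot y)=\sigma(x)\odot\sigma(y)$; then $(A,\sigma)$ is a state-morphism BL-algebra. The image $\sigma(A)$ is a subalgebra of $A$, regarded as a BL-algebra. $\mathrm{Ker}(\sigma)=\{x\in A:\sigma(x)=1\}$. A filter is a nonempty subset closed under $\odot$ and upward closed; a maximal filter is a proper filter not strictly contained in another proper filter; $\mathrm{Rad}(B)$ is the intersection of all maximal filters of a BL-algebra $B$. A state BL-algebra $(A,\sigma)$ is semisimple if $\mathrm{Rad}(\sigma(A))=\{1\}$. -}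

module Defs where

open import Level using (Level; suc; _⊔_)
open import Relation.Binary.PropositionalEquality using (_≡_)
open import Relation.Nullary using (¬_)
open import Relation.Unary using (Pred; _⊆_; _∈_; _∉_)
open import Data.Product using (Σ; ∃; ∃-syntax; _×_)

record BLAlgebra (a : Level) : Set (suc a) where
  infixr 6 _∨_
  infixr 7 _∧_
  infixr 7 _⊙_
  infixr 5 _⇒_
  field
    Carrier : Set a
    _∧_ _∨_ _⊙_ _⇒_ : Carrier → Carrier → Carrier
    𝟘 𝟙 : Carrier
    ∧-comm   : ∀ x y → x ∧ y ≡ y ∧ x
    ∨-comm   : ∀ x y → x ∨ y ≡ y ∨ x
    ∧-assoc  : ∀ x y z → (x ∧ y) ∧ z ≡ x ∧ (y ∧ z)
    ∨-assoc  : ∀ x y z → (x ∨ y) ∨ z ≡ x ∨ (y ∨ z)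
    ∧-absorb : ∀ x y → x ∧ (x ∨ y) ≡ x
    ∨-absorb : ∀ x y → x ∨ (x ∧ y) ≡ x
    𝟘-bot    : ∀ x → 𝟘 ∧ x ≡ 𝟘
    𝟙-top    : ∀ x → x ∧ 𝟙 ≡ x
    ⊙-comm   : ∀ x y → x ⊙ y ≡ y ⊙ x
    ⊙-assoc  : ∀ x y z → (x ⊙ y) ⊙ z ≡ x ⊙ (y ⊙ z)
    ⊙-idʳ    : ∀ x → x ⊙ 𝟙 ≡ x

  _≤_ : Carrier → Carrier → Set a
  x ≤ y = x ∧ y ≡ x

  field
    residuation₁ : ∀ a b c → c ≤ (a ⇒ b) → (a ⊙ c) ≤ b
    residuation₂ : ∀ a b c → (a ⊙ c) ≤ b → c ≤ (a ⇒ b)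
    divisibility : ∀ a b → a ∧ b ≡ a ⊙ (a ⇒ b)
    prelinearity : ∀ a b → (a ⇒ b) ∨ (b ⇒ a) ≡ 𝟙

module _ {a : Level} (B : BLAlgebra a) where
  open BLAlgebra B

  record IsStateMorphism (σ : Carrier → Carrier) : Set a where
    field
      σ-𝟘   : σ 𝟘 ≡ 𝟘
      σ-⇒   : ∀ x y → σ (x ⇒ y) ≡ σ x ⇒ σ (x ∧ y)
      σ-σ⊙  : ∀ x y → σ (σ x ⊙ σ y) ≡ σ x ⊙ σ y
      σ-σ⇒  : ∀ x y → σ (σ x ⇒ σ y) ≡ σ x ⇒ σ y
      σ-⊙   : ∀ x y → σ (x ⊙ y) ≡ σ x ⊙ σ y

  -- Filters of the subalgebra of A with universe S (a subset of A closed
  -- under the operations).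
  record IsFilterIn (S : Pred Carrier a) (F : Pred Carrier a) : Set a where
    field
      inS      : F ⊆ S
      nonempty : ∃[ x ] F x
      ⊙-closed : ∀ {x y} → F x → F y → F (x ⊙ y)
      up-closed : ∀ {x y} → F x → S y → x ≤ y → F y

  IsProperFilterIn : Pred Carrier a → Pred Carrier a → Set a
  IsProperFilterIn S F = IsFilterIn S F × (∃[ x ] (S x × ¬ F x))

  IsMaximalFilterIn : Pred Carrier a → Pred Carrier a → Set (suc a)
  IsMaximalFilterIn S F =
    IsProperFilterIn S F ×
    (∀ (G : Pred Carrier a) → IsProperFilterIn S G → F ⊆ G → G ⊆ F)

  RadIn : Pred Carrier a → Pred Carrier (suc a)
  RadIn S x = S x × (∀ (M : Pred Carrier a) → IsMaximalFilterIn S M → M x)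

  Univ : Pred Carrier a
  Univ _ = Carrier

  Rad : Pred Carrier (suc a)
  Rad = RadIn Univ

  Image : (Carrier → Carrier) → Pred Carrier a
  Image σ x = ∃[ y ] (σ y ≡ x)

  Ker : (Carrier → Carrier) → Pred Carrier a
  Ker σ x = σ x ≡ 𝟙

  IsSemisimple : (Carrier → Carrier) → Set (suc a)
  IsSemisimple σ = (∀ x → RadIn (Image σ) x → x ≡ 𝟙) × RadIn (Image σ) 𝟙

-- A maximal filter M of A restricts to the maximal filter M ∩ σ(A) of σ(A), and a
-- maximal filter N of σ(A) pulls back to the maximal filter σ⁻¹(N) of A.  Both are
-- instances of one transfer lemma: the preimage of a maximal filter under a map that
-- preserves ⊙, 0 and negation is maximal, because any proper filter G above the
-- preimage generates, together with M, a proper filter upstairs (m ⊙ h g ≤ 0 would put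
-- h(¬g) in M, hence ¬g in G, hence g ⊙ ¬g = 0 in G).  So Rad(σ(A)) consists of the
-- σ x with x ∈ Rad(A), and since σ is idempotent, Rad(σ(A)) = {1} iff σ kills Rad(A).
module Submission where

open import Defs
open import Level using (Level)
open import Function.Bundles using (_⇔_; mk⇔)
open import Relation.Unary using (Pred; _⊆_)
open import Relation.Binary.PropositionalEquality
open import Relation.Binary.PropositionalEquality.Algebra using (isMagma)
open import Relation.Nullary using (¬_)
open import Data.Product using (∃-syntax; _×_; _,_; proj₁; proj₂)
open import Algebra.Bundles using (CommutativeSemigroup)
import Algebra.Properties.CommutativeSemigroup as CommutativeSemigroupProperties

module _ {a : Level} (A : BLAlgebra a) where
  open BLAlgebra A
  open IsFilterIn
  open ≡-Reasoning

  -- The order of Defs has no fixity declaration, so it would bind tighter than ⊙.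
  infix 4 _≼_
  _≼_ : Carrier → Carrier → Set a
  _≼_ = _≤_

  ⊙-commutativeSemigroup : CommutativeSemigroup a a
  ⊙-commutativeSemigroup = record
    { isCommutativeSemigroup = record
      { isSemigroup = record { isMagma = isMagma _⊙_ ; assoc = ⊙-assoc }
      ; comm = ⊙-comm
      }
    }

  open CommutativeSemigroupProperties ⊙-commutativeSemigroup using (interchange)

  ≤-refl : ∀ x → x ≼ x
  ≤-refl x = trans (cong (x ∧_) (sym (∨-absorb x x))) (∧-absorb x (x ∧ x))

  ≤-trans : ∀ {x y z} → x ≼ y → y ≼ z → x ≼ z
  ≤-trans {x} {y} {z} x≤y y≤z = begin
    x ∧ z       ≡⟨ cong (_∧ z) x≤y ⟨
    (x ∧ y) ∧ z ≡⟨ ∧-assoc x y z ⟩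
    x ∧ (y ∧ z) ≡⟨ cong (x ∧_) y≤z ⟩
    x ∧ y       ≡⟨ x≤y ⟩
    x           ∎

  ≤-reflexive : ∀ {x y} → x ≡ y → x ≼ y
  ≤-reflexive {x} refl = ≤-refl x

  ⊙-identityˡ : ∀ x → 𝟙 ⊙ x ≡ x
  ⊙-identityˡ x = trans (⊙-comm 𝟙 x) (⊙-idʳ x)

  ⊙-monoʳ-≤ : ∀ z {x y} → x ≼ y → z ⊙ x ≼ z ⊙ y
  ⊙-monoʳ-≤ z {x} {y} x≤y =
    residuation₁ z (z ⊙ y) x (≤-trans x≤y (residuation₂ z (z ⊙ y) y (≤-refl _)))

  ⊙-mono-≤ : ∀ {x y u v} → x ≼ y → u ≼ v → x ⊙ u ≼ y ⊙ v
  ⊙-mono-≤ {x} {y} {u} {v} x≤y u≤v = ≤-trans x⊙u≤y⊙u (⊙-monoʳ-≤ y u≤v)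
    where
    x⊙u≤y⊙u : x ⊙ u ≼ y ⊙ u
    x⊙u≤y⊙u = subst₂ _≼_ (⊙-comm u x) (⊙-comm u y) (⊙-monoʳ-≤ u x≤y)

  x⊙y≤x : ∀ x y → x ⊙ y ≼ x
  x⊙y≤x x y = subst (x ⊙ y ≼_) (⊙-idʳ x) (⊙-monoʳ-≤ x (𝟙-top y))

  x≤y⇒x≡y⊙[y⇒x] : ∀ {x y} → x ≼ y → x ≡ y ⊙ (y ⇒ x)
  x≤y⇒x≡y⊙[y⇒x] {x} {y} x≤y = trans (sym x≤y) (trans (∧-comm x y) (divisibility y x))

  x⊙¬x≡𝟘 : ∀ x → x ⊙ (x ⇒ 𝟘) ≡ 𝟘
  x⊙¬x≡𝟘 x = trans (sym (divisibility x 𝟘)) (trans (∧-comm x 𝟘) (𝟘-bot x))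

  ¬𝟘≡𝟙 : 𝟘 ⇒ 𝟘 ≡ 𝟙
  ¬𝟘≡𝟙 = trans (sym (𝟙-top (𝟘 ⇒ 𝟘))) (trans (∧-comm _ _) 𝟙≤¬𝟘)
    where
    𝟙≤¬𝟘 : 𝟙 ≼ 𝟘 ⇒ 𝟘
    𝟙≤¬𝟘 = residuation₂ 𝟘 𝟘 𝟙 (≤-reflexive (⊙-idʳ 𝟘))

  x⊙y≤𝟘⇒x≤¬y : ∀ {x y} → x ⊙ y ≼ 𝟘 → x ≼ y ⇒ 𝟘
  x⊙y≤𝟘⇒x≤¬y {x} {y} x⊙y≤𝟘 = residuation₂ y 𝟘 x (subst (_≼ 𝟘) (⊙-comm x y) x⊙y≤𝟘)

  filter-𝟙 : ∀ {T F} → IsFilterIn A T F → T 𝟙 → F 𝟙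
  filter-𝟙 isF T𝟙 = up-closed isF (proj₂ (nonempty isF)) T𝟙 (𝟙-top _)

  proper-𝟘∉ : ∀ {T F} → IsProperFilterIn A T F → ¬ F 𝟘
  proper-𝟘∉ (isF , x , Tx , x∉F) F𝟘 = x∉F (up-closed isF F𝟘 Tx (𝟘-bot x))

  𝟙∈Rad : ∀ {T} → T 𝟙 → RadIn A T 𝟙
  𝟙∈Rad T𝟙 = T𝟙 , λ M M-max → filter-𝟙 (proj₁ (proj₁ M-max)) T𝟙

  record IsSubuniverse (T : Pred Carrier a) : Set a where
    field
      𝟘∈ : T 𝟘
      𝟙∈ : T 𝟙
      ⊙-closed : ∀ {x y} → T x → T y → T (x ⊙ y)
      ¬-closed : ∀ {x} → T x → T (x ⇒ 𝟘)

  record IsMorphism (T U : Pred Carrier a) (h : Carrier → Carrier) : Set a where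
    field
      maps : ∀ {x} → T x → U (h x)
      h-𝟘 : h 𝟘 ≡ 𝟘
      h-⊙ : ∀ x y → h (x ⊙ y) ≡ h x ⊙ h y
      h-¬ : ∀ x → h (x ⇒ 𝟘) ≡ h x ⇒ 𝟘

    h-𝟙 : h 𝟙 ≡ 𝟙
    h-𝟙 = begin
      h 𝟙       ≡⟨ cong h ¬𝟘≡𝟙 ⟨
      h (𝟘 ⇒ 𝟘) ≡⟨ h-¬ 𝟘 ⟩
      h 𝟘 ⇒ 𝟘   ≡⟨ cong (_⇒ 𝟘) h-𝟘 ⟩
      𝟘 ⇒ 𝟘     ≡⟨ ¬𝟘≡𝟙 ⟩
      𝟙         ∎

    h-mono : ∀ {x y} → x ≼ y → h x ≼ h y
    h-mono {x} {y} x≤y = subst (_≼ h y) h[y⊙[y⇒x]]≡hx (x⊙y≤x (h y) (h (y ⇒ x)))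
      where
      h[y⊙[y⇒x]]≡hx : h y ⊙ h (y ⇒ x) ≡ h x
      h[y⊙[y⇒x]]≡hx = trans (sym (h-⊙ y (y ⇒ x))) (cong h (sym (x≤y⇒x≡y⊙[y⇒x] x≤y)))

  comap : Pred Carrier a → (Carrier → Carrier) → Pred Carrier a → Pred Carrier a
  comap T h F x = T x × F (h x)

  module Transfer {T U : Pred Carrier a} {h : Carrier → Carrier}
                  (T-sub : IsSubuniverse T) (U-sub : IsSubuniverse U)
                  (h-mor : IsMorphism T U h) where
    open IsSubuniverse
    open IsMorphism h-mor

    comap-isFilter : ∀ {F} → IsFilterIn A U F → IsFilterIn A T (comap T h F)
    inS (comap-isFilter {F} isF) = proj₁
    nonempty (comap-isFilter {F} isF) = 𝟙 , 𝟙∈ T-sub , subst F (sym h-𝟙) (filter-𝟙 isF (𝟙∈ U-sub))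
    ⊙-closed (comap-isFilter {F} isF) {x} {y} (Tx , Fhx) (Ty , Fhy) =
      ⊙-closed T-sub Tx Ty , subst F (sym (h-⊙ x y)) (IsFilterIn.⊙-closed isF Fhx Fhy)
    up-closed (comap-isFilter {F} isF) (_ , Fhx) Ty x≤y = Ty , up-closed isF Fhx (maps Ty) (h-mono x≤y)

    comap-isProper : ∀ {F} → IsProperFilterIn A U F → IsProperFilterIn A T (comap T h F)
    comap-isProper {F} F-proper@(isF , _) =
      comap-isFilter isF , 𝟘 , 𝟘∈ T-sub , λ (_ , Fh𝟘) → proper-𝟘∉ F-proper (subst F h-𝟘 Fh𝟘)

    join : Pred Carrier a → Pred Carrier a → Pred Carrier a
    join F G z = U z × ∃[ m ] ∃[ g ] (F m × G g × m ⊙ h g ≼ z)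

    join-isFilter : ∀ {F G} → IsFilterIn A U F → IsFilterIn A T G → IsFilterIn A U (join F G)
    inS (join-isFilter _ _) = proj₁
    nonempty (join-isFilter isF isG) =
      𝟙 , 𝟙∈ U-sub , 𝟙 , 𝟙 , filter-𝟙 isF (𝟙∈ U-sub) , filter-𝟙 isG (𝟙∈ T-sub) , 𝟙-top _
    ⊙-closed (join-isFilter isF isG) {z} {z′} (Uz , m , g , Fm , Gg , ≤z) (Uz′ , m′ , g′ , Fm′ , Gg′ , ≤z′) =
      ⊙-closed U-sub Uz Uz′ , m ⊙ m′ , g ⊙ g′ ,
      IsFilterIn.⊙-closed isF Fm Fm′ , IsFilterIn.⊙-closed isG Gg Gg′ ,
      subst (_≼ z ⊙ z′) regroup (⊙-mono-≤ ≤z ≤z′)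
      where
      regroup : (m ⊙ h g) ⊙ (m′ ⊙ h g′) ≡ (m ⊙ m′) ⊙ h (g ⊙ g′)
      regroup = trans (interchange m (h g) m′ (h g′)) (cong ((m ⊙ m′) ⊙_) (sym (h-⊙ g g′)))
    up-closed (join-isFilter _ _) (_ , m , g , Fm , Gg , ≤z) Uz′ z≤z′ =
      Uz′ , m , g , Fm , Gg , ≤-trans ≤z z≤z′

    join-isProper : ∀ {F G} → IsProperFilterIn A U F → IsProperFilterIn A T G →
                    comap T h F ⊆ G → IsProperFilterIn A U (join F G)
    join-isProper {F} {G} (isF , _) G-proper@(isG , _) F⊆G =
      join-isFilter isF isG , 𝟘 , 𝟘∈ U-sub , 𝟘∉join
      where
      𝟘∉join : ¬ join F G 𝟘
      𝟘∉join (_ , m , g , Fm , Gg , m⊙hg≤𝟘) = proper-𝟘∉ G-proper (subst G (x⊙¬x≡𝟘 g) g⊙¬g∈G)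
        where
        T¬g : T (g ⇒ 𝟘)
        T¬g = ¬-closed T-sub (inS isG Gg)
        Fh¬g : F (h (g ⇒ 𝟘))
        Fh¬g = up-closed isF Fm (maps T¬g) (subst (m ≼_) (sym (h-¬ g)) (x⊙y≤𝟘⇒x≤¬y m⊙hg≤𝟘))
        g⊙¬g∈G : G (g ⊙ (g ⇒ 𝟘))
        g⊙¬g∈G = IsFilterIn.⊙-closed isG Gg (F⊆G (T¬g , Fh¬g))

    comap-isMaximal : ∀ {M} → IsMaximalFilterIn A U M → IsMaximalFilterIn A T (comap T h M)
    comap-isMaximal {M} (M-proper@(isM , _) , M-max) = comap-isProper M-proper , comap-max
      where
      comap-max : ∀ G → IsProperFilterIn A T G → comap T h M ⊆ G → G ⊆ comap T h M
      comap-max G G-proper@(isG , _) M⊆G {x} Gx = inS isG Gx , M-max (join M G) join-proper M⊆join hx∈join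
        where
        join-proper : IsProperFilterIn A U (join M G)
        join-proper = join-isProper M-proper G-proper M⊆G
        M⊆join : M ⊆ join M G
        M⊆join {m} Mm = inS isM Mm , m , 𝟙 , Mm , filter-𝟙 isG (𝟙∈ T-sub) ,
                        ≤-reflexive (trans (cong (m ⊙_) h-𝟙) (⊙-idʳ m))
        hx∈join : join M G (h x)
        hx∈join = maps (inS isG Gx) , 𝟙 , x , filter-𝟙 isM (𝟙∈ U-sub) , Gx , ≤-reflexive (⊙-identityˡ (h x))

  Univ-isSubuniverse : IsSubuniverse (Univ A)
  Univ-isSubuniverse = record { 𝟘∈ = 𝟘 ; 𝟙∈ = 𝟙 ; ⊙-closed = λ _ _ → 𝟙 ; ¬-closed = λ _ → 𝟙 }

  module StateMorphism {σ : Carrier → Carrier} (σ-sm : IsStateMorphism A σ) where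
    open IsStateMorphism σ-sm

    σ-¬ : ∀ x → σ (x ⇒ 𝟘) ≡ σ x ⇒ 𝟘
    σ-¬ x = begin
      σ (x ⇒ 𝟘)       ≡⟨ σ-⇒ x 𝟘 ⟩
      σ x ⇒ σ (x ∧ 𝟘) ≡⟨ cong (λ t → σ x ⇒ σ t) (trans (∧-comm x 𝟘) (𝟘-bot x)) ⟩
      σ x ⇒ σ 𝟘       ≡⟨ cong (σ x ⇒_) σ-𝟘 ⟩
      σ x ⇒ 𝟘         ∎

    σ-isMorphism : IsMorphism (Univ A) (Image A σ) σ
    σ-isMorphism = record { maps = λ {x} _ → x , refl ; h-𝟘 = σ-𝟘 ; h-⊙ = σ-⊙ ; h-¬ = σ-¬ }

    open IsMorphism σ-isMorphism using () renaming (h-𝟙 to σ-𝟙)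

    σ-idem : ∀ x → σ (σ x) ≡ σ x
    σ-idem x = begin
      σ (σ x)         ≡⟨ cong σ (⊙-idʳ (σ x)) ⟨
      σ (σ x ⊙ 𝟙)     ≡⟨ cong (λ t → σ (σ x ⊙ t)) σ-𝟙 ⟨
      σ (σ x ⊙ σ 𝟙)   ≡⟨ σ-σ⊙ x 𝟙 ⟩
      σ x ⊙ σ 𝟙       ≡⟨ cong (σ x ⊙_) σ-𝟙 ⟩
      σ x ⊙ 𝟙         ≡⟨ ⊙-idʳ (σ x) ⟩
      σ x             ∎

    Image-isSubuniverse : IsSubuniverse (Image A σ)
    Image-isSubuniverse = record
      { 𝟘∈ = 𝟘 , σ-𝟘
      ; 𝟙∈ = 𝟙 , σ-𝟙
      ; ⊙-closed = λ { (x , refl) (y , refl) → σ x ⊙ σ y , σ-σ⊙ x y }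
      ; ¬-closed = λ { (x , refl) → σ x ⇒ 𝟘 , trans (σ-¬ (σ x)) (cong (_⇒ 𝟘) (σ-idem x)) }
      }

    inclusion-isMorphism : IsMorphism (Image A σ) (Univ A) (λ x → x)
    inclusion-isMorphism = record { maps = λ _ → 𝟙 ; h-𝟘 = refl ; h-⊙ = λ _ _ → refl ; h-¬ = λ _ → refl }

    σ-maps-Rad : ∀ {x} → Rad A x → RadIn A (Image A σ) (σ x)
    σ-maps-Rad {x} (_ , x∈M) = (x , refl) , λ N N-max → proj₂ (x∈M _ (comap-isMaximal N-max))
      where open Transfer Univ-isSubuniverse Image-isSubuniverse σ-isMorphism

    Rad-Image⊆Rad : RadIn A (Image A σ) ⊆ Rad A
    Rad-Image⊆Rad (_ , x∈N) = 𝟙 , λ M M-max → proj₂ (x∈N _ (comap-isMaximal M-max))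
      where open Transfer Image-isSubuniverse Univ-isSubuniverse inclusion-isMorphism

theorem7p5 : {a : Level} (A : BLAlgebra a) (σ : BLAlgebra.Carrier A → BLAlgebra.Carrier A) →
    IsStateMorphism A σ →
    IsSemisimple A σ ⇔ (Rad A ⊆ Ker A σ)
theorem7p5 A σ σ-sm = mk⇔ semisimple⇒Rad⊆Ker Rad⊆Ker⇒semisimple
  where
  open BLAlgebra A using (𝟙)
  open StateMorphism A σ-sm

  semisimple⇒Rad⊆Ker : IsSemisimple A σ → Rad A ⊆ Ker A σ
  semisimple⇒Rad⊆Ker (Rad≡𝟙 , _) x∈Rad = Rad≡𝟙 _ (σ-maps-Rad x∈Rad)

  Rad⊆Ker⇒semisimple : Rad A ⊆ Ker A σ → IsSemisimple A σ
  Rad⊆Ker⇒semisimple Rad⊆Ker = Rad≡𝟙 , 𝟙∈Rad A (IsSubuniverse.𝟙∈ Image-isSubuniverse)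
    where
    Rad≡𝟙 : ∀ x → RadIn A (Image A σ) x → x ≡ 𝟙
    Rad≡𝟙 x x∈Rad@((y , refl) , _) = trans (sym (σ-idem y)) (Rad⊆Ker (Rad-Image⊆Rad x∈Rad))
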